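{- Let $d>0$ be an integer, let $N\geq d$ be an integer, and let $c\geq 0$ and $m>0$ be integers. Then $\operatorname{div}(n,d)=\operatorname{div}(c\cdot n+c,\,m)$ for all integers $n\in[0,N]$ if and only if $$\left(1-\frac{1}{N-\operatorname{rem}(N,d)+1}\right)\frac1d\leq \frac cm<\frac1d.$$
   Context: For a non-negative real $x$ and a positive real $y$, define $\operatorname{div}(x,y)=\lfloor x/y\rfloor$ and $\operatorname{rem}(x,y)=x-\lfloor x/y\rfloor\cdot y$, where $\lfloor\cdot\rfloor$ is the floor function. -}

-- With q = n / d, the floors agree at n iff q * m ≤ c * n + c < (1 + q) * m. At n = d - 1
-- the upper bound says c * d < m, and conversely c * d < m gives it everywhere, since
-- c * (n + 1) ≤ c * (1 + q) * d. Given c * d < m, the lower bound is weakest at n = q * d, and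
-- the slack q * (m - c * d) ≤ c only grows with q, so the single binding instance is
-- n = N / d * d = N ∸ N % d. Clearing denominators turns the two conditions into the two
-- rational bounds.
module Submission where

open import Data.Nat using (ℕ; suc; _+_; _*_; _∸_; _≤_; _<_; NonZero)
open import Data.Nat.Properties
open import Data.Nat.DivMod
open import Data.Integer as ℤ using (+_)
import Data.Integer.Properties as ℤ
import Data.Rational as ℚ
open ℚ using (toℚᵘ)
open import Data.Rational.Properties
  using (toℚᵘ-fromℚᵘ; toℚᵘ-injective; toℚᵘ-homo-+; toℚᵘ-homo‿-; toℚᵘ-homo-*;
         toℚᵘ-mono-≤; toℚᵘ-cancel-≤; toℚᵘ-mono-<; toℚᵘ-cancel-<)
import Data.Rational.Unnormalised as ℚᵘ
import Data.Rational.Unnormalised.Properties as ℚᵘ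
open import Data.Product using (_×_; _,_)
open import Data.Product.Function.NonDependent.Propositional using (_×-⇔_)
open import Function.Bundles using (_⇔_; mk⇔)
import Function.Properties.Equivalence as ⇔
open import Relation.Binary.PropositionalEquality
open import Algebra.Properties.CommutativeSemigroup *-commutativeSemigroup using (x∙yz≈y∙xz)

q*n≤m<[1+q]*n⇒m/n≡q : ∀ {m n q} .{{_ : NonZero n}} → q * n ≤ m → m < suc q * n → m / n ≡ q
q*n≤m<[1+q]*n⇒m/n≡q {m} {n} {q} lo hi =
  ≤-antisym (<⇒≤pred (m<n*o⇒m/o<n hi)) (subst (_≤ m / n) (m*n/n≡m q n) (/-monoˡ-≤ n lo))

m<[1+m/n]*n : ∀ m n .{{_ : NonZero n}} → m < suc (m / n) * n
m<[1+m/n]*n m n = begin-strict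
  m                 ≡⟨ m≡m%n+[m/n]*n m n ⟩
  m % n + m / n * n <⟨ +-monoˡ-< (m / n * n) (m%n<n m n) ⟩
  n + m / n * n     ∎
  where open ≤-Reasoning

m∸m%n≡m/n*n : ∀ m n .{{_ : NonZero n}} → m ∸ m % n ≡ m / n * n
m∸m%n≡m/n*n m n = trans (cong (_∸ m % n) (m≡m%n+[m/n]*n m n)) (m+n∸m≡n (m % n) (m / n * n))

l*a≤l*b+c⇒k*a≤k*b+c : ∀ {a b c k l} → b ≤ a → k ≤ l → l * a ≤ l * b + c → k * a ≤ k * b + c
l*a≤l*b+c⇒k*a≤k*b+c {a} {b} {c} {k} {l} b≤a k≤l h = +-cancelʳ-≤ (j * a) (k * a) (k * b + c) (begin
  k * a + j * a         ≡⟨ *-distribʳ-+ a k j ⟨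
  (k + j) * a           ≡⟨ cong (_* a) k+j≡l ⟩
  l * a                 ≤⟨ h ⟩
  l * b + c             ≡⟨ cong (λ x → x * b + c) k+j≡l ⟨
  (k + j) * b + c       ≡⟨ cong (_+ c) (*-distribʳ-+ b k j) ⟩
  k * b + j * b + c     ≡⟨ +-assoc (k * b) (j * b) c ⟩
  k * b + (j * b + c)   ≡⟨ cong (λ x → k * b + x) (+-comm (j * b) c) ⟩
  k * b + (c + j * b)   ≡⟨ +-assoc (k * b) c (j * b) ⟨
  k * b + c + j * b     ≤⟨ +-monoʳ-≤ (k * b + c) (*-monoʳ-≤ j b≤a) ⟩
  k * b + c + j * a     ∎)
  where
  open ≤-Reasoning
  j = l ∸ k
  k+j≡l : k + j ≡ l
  k+j≡l = m+[n∸m]≡n k≤l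

c*n+c≡c*[1+n] : ∀ c n → c * n + c ≡ c * suc n
c*n+c≡c*[1+n] c n = trans (+-comm (c * n) c) (sym (*-suc c n))

FloorsAgreeUpTo : (N d c m : ℕ) .{{_ : NonZero d}} .{{_ : NonZero m}} → Set
FloorsAgreeUpTo N d c m = ∀ n → n ≤ N → n / d ≡ (c * n + c) / m

floorsAgree⇒c*d<m : ∀ {N d c m} .{{_ : NonZero d}} .{{_ : NonZero m}} →
  d ≤ N → FloorsAgreeUpTo N d c m → c * d < m
floorsAgree⇒c*d<m {d = suc k} {c} {m} k<N agree = subst (_< m) (c*n+c≡c*[1+n] c k) (m/n≡0⇒m<n (begin
  (c * k + c) / m ≡⟨ agree k (<⇒≤ k<N) ⟨
  k / suc k       ≡⟨ m<n⇒m/n≡0 (n<1+n k) ⟩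
  0               ∎))
  where open ≡-Reasoning

module _ {N d c m : ℕ} .{{_ : NonZero d}} .{{_ : NonZero m}} where

  floorsAgree⇒threshold : FloorsAgreeUpTo N d c m → N / d * m ≤ c * (N / d * d) + c
  floorsAgree⇒threshold agree = subst (λ q → q * m ≤ c * L + c) [cL+c]/m≡Q (m/n*n≤m (c * L + c) m)
    where
    L = N / d * d
    [cL+c]/m≡Q : (c * L + c) / m ≡ N / d
    [cL+c]/m≡Q = trans (sym (agree L (m/n*n≤m N d))) (m*n/n≡m (N / d) d)

  threshold⇒floorsAgree : c * d < m → N / d * m ≤ c * (N / d * d) + c → FloorsAgreeUpTo N d c m
  threshold⇒floorsAgree c*d<m threshold n n≤N = sym (q*n≤m<[1+q]*n⇒m/n≡q lower upper)
    where
    q = n / d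
    cqd≡qcd : ∀ q → c * (q * d) ≡ q * (c * d)
    cqd≡qcd q = x∙yz≈y∙xz c q d
    lower : q * m ≤ c * n + c
    lower = begin
      q * m             ≤⟨ l*a≤l*b+c⇒k*a≤k*b+c (<⇒≤ c*d<m) (/-monoˡ-≤ d n≤N)
                            (subst (λ x → N / d * m ≤ x + c) (cqd≡qcd (N / d)) threshold) ⟩
      q * (c * d) + c   ≡⟨ cong (_+ c) (cqd≡qcd q) ⟨
      c * (q * d) + c   ≤⟨ +-monoˡ-≤ c (*-monoʳ-≤ c (m/n*n≤m n d)) ⟩
      c * n + c         ∎
      where open ≤-Reasoning
    upper : c * n + c < suc q * m
    upper = begin-strict
      c * n + c         ≡⟨ c*n+c≡c*[1+n] c n ⟩
      c * suc n         ≤⟨ *-monoʳ-≤ c (m<[1+m/n]*n n d) ⟩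
      c * (suc q * d)   ≡⟨ cqd≡qcd (suc q) ⟩
      suc q * (c * d)   <⟨ *-monoʳ-< (suc q) c*d<m ⟩
      suc q * m         ∎
      where open ≤-Reasoning

  floorsAgree⇔ : d ≤ N → FloorsAgreeUpTo N d c m ⇔ ((N / d * m ≤ c * (N / d * d) + c) × (c * d < m))
  floorsAgree⇔ d≤N = mk⇔
    (λ agree → floorsAgree⇒threshold agree , floorsAgree⇒c*d<m {c = c} d≤N agree)
    (λ (threshold , c*d<m) → threshold⇒floorsAgree c*d<m threshold)

Q*d*m≤c*[[1+Q*d]*d]⇔Q*m≤c*[Q*d]+c : ∀ Q d m c .{{_ : NonZero d}} →
  Q * d * m ≤ c * (suc (Q * d) * d) ⇔ Q * m ≤ c * (Q * d) + c
Q*d*m≤c*[[1+Q*d]*d]⇔Q*m≤c*[Q*d]+c Q d m c =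
  subst₂ (λ x y → x ≤ y ⇔ Q * m ≤ c * (Q * d) + c) Qdm≡Qm*d c[1+Qd]d≡[cQd+c]*d
    (mk⇔ (*-cancelʳ-≤ (Q * m) (c * (Q * d) + c) d) (*-monoˡ-≤ d))
  where
  open ≡-Reasoning
  Qdm≡Qm*d : Q * m * d ≡ Q * d * m
  Qdm≡Qm*d = begin
    Q * m * d   ≡⟨ *-assoc Q m d ⟩
    Q * (m * d) ≡⟨ cong (Q *_) (*-comm m d) ⟩
    Q * (d * m) ≡⟨ *-assoc Q d m ⟨
    Q * d * m   ∎
  c[1+Qd]d≡[cQd+c]*d : (c * (Q * d) + c) * d ≡ c * (suc (Q * d) * d)
  c[1+Qd]d≡[cQd+c]*d = begin
    (c * (Q * d) + c) * d ≡⟨ cong (_* d) (c*n+c≡c*[1+n] c (Q * d)) ⟩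
    c * suc (Q * d) * d   ≡⟨ *-assoc c (suc (Q * d)) d ⟩
    c * (suc (Q * d) * d) ∎

toℚᵘ-/ : ∀ i n .{{_ : NonZero n}} → toℚᵘ (i ℚ./ n) ℚᵘ.≃ i ℚᵘ./ n
toℚᵘ-/ i (suc n) = toℚᵘ-fromℚᵘ (i ℚᵘ./ suc n)

toℚᵘ-≤⇔ : ∀ {p q p′ q′} → toℚᵘ p ℚᵘ.≃ p′ → toℚᵘ q ℚᵘ.≃ q′ → p ℚ.≤ q ⇔ p′ ℚᵘ.≤ q′
toℚᵘ-≤⇔ p≃p′ q≃q′ = mk⇔
  (λ p≤q → ℚᵘ.≤-respʳ-≃ q≃q′ (ℚᵘ.≤-respˡ-≃ p≃p′ (toℚᵘ-mono-≤ p≤q)))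
  (λ p′≤q′ → toℚᵘ-cancel-≤ (ℚᵘ.≤-respʳ-≃ (ℚᵘ.≃-sym q≃q′) (ℚᵘ.≤-respˡ-≃ (ℚᵘ.≃-sym p≃p′) p′≤q′)))

toℚᵘ-<⇔ : ∀ {p q p′ q′} → toℚᵘ p ℚᵘ.≃ p′ → toℚᵘ q ℚᵘ.≃ q′ → p ℚ.< q ⇔ p′ ℚᵘ.< q′
toℚᵘ-<⇔ p≃p′ q≃q′ = mk⇔
  (λ p<q → ℚᵘ.<-respʳ-≃ q≃q′ (ℚᵘ.<-respˡ-≃ p≃p′ (toℚᵘ-mono-< p<q)))
  (λ p′<q′ → toℚᵘ-cancel-< (ℚᵘ.<-respʳ-≃ (ℚᵘ.≃-sym q≃q′) (ℚᵘ.<-respˡ-≃ (ℚᵘ.≃-sym p≃p′) p′<q′)))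

+a/b≤ᵘ+c/e⇔a*e≤c*b : ∀ a b c e .{{_ : NonZero b}} .{{_ : NonZero e}} →
  (+ a ℚᵘ./ b ℚᵘ.≤ + c ℚᵘ./ e) ⇔ (a * e ≤ c * b)
+a/b≤ᵘ+c/e⇔a*e≤c*b a b@(suc _) c e@(suc _) = mk⇔
  (λ { (ℚᵘ.*≤* ae≤cb) → ℤ.drop‿+≤+ (subst₂ ℤ._≤_ (sym (ℤ.pos-* a e)) (sym (ℤ.pos-* c b)) ae≤cb) })
  (λ ae≤cb → ℚᵘ.*≤* (subst₂ ℤ._≤_ (ℤ.pos-* a e) (ℤ.pos-* c b) (ℤ.+≤+ ae≤cb)))

+a/b<ᵘ+c/e⇔a*e<c*b : ∀ a b c e .{{_ : NonZero b}} .{{_ : NonZero e}} →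
  (+ a ℚᵘ./ b ℚᵘ.< + c ℚᵘ./ e) ⇔ (a * e < c * b)
+a/b<ᵘ+c/e⇔a*e<c*b a b@(suc _) c e@(suc _) = mk⇔
  (λ { (ℚᵘ.*<* ae<cb) → ℤ.drop‿+<+ (subst₂ ℤ._<_ (sym (ℤ.pos-* a e)) (sym (ℤ.pos-* c b)) ae<cb) })
  (λ ae<cb → ℚᵘ.*<* (subst₂ ℤ._<_ (ℤ.pos-* a e) (ℤ.pos-* c b) (ℤ.+<+ ae<cb)))

+a/b≤+c/e⇔a*e≤c*b : ∀ a b c e .{{_ : NonZero b}} .{{_ : NonZero e}} →
  (+ a ℚ./ b ℚ.≤ + c ℚ./ e) ⇔ (a * e ≤ c * b)
+a/b≤+c/e⇔a*e≤c*b a b c e =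
  ⇔.trans (toℚᵘ-≤⇔ (toℚᵘ-/ (+ a) b) (toℚᵘ-/ (+ c) e)) (+a/b≤ᵘ+c/e⇔a*e≤c*b a b c e)

+a/b<+c/e⇔a*e<c*b : ∀ a b c e .{{_ : NonZero b}} .{{_ : NonZero e}} →
  (+ a ℚ./ b ℚ.< + c ℚ./ e) ⇔ (a * e < c * b)
+a/b<+c/e⇔a*e<c*b a b c e =
  ⇔.trans (toℚᵘ-<⇔ (toℚᵘ-/ (+ a) b) (toℚᵘ-/ (+ c) e)) (+a/b<ᵘ+c/e⇔a*e<c*b a b c e)

[1-1/[1+L]]*[1/d]≡L/[[1+L]*d] : ∀ L d .{{_ : NonZero d}} →
  (ℚ.1ℚ ℚ.- + 1 ℚ./ suc L) ℚ.* (+ 1 ℚ./ d) ≡ (+ L ℚ./ (suc L * d)) {{m*n≢0 (suc L) d}}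
[1-1/[1+L]]*[1/d]≡L/[[1+L]*d] L d@(suc _) = toℚᵘ-injective (begin
  toℚᵘ ((ℚ.1ℚ ℚ.- + 1 ℚ./ suc L) ℚ.* (+ 1 ℚ./ d))     ≈⟨ toℚᵘ-homo-* (ℚ.1ℚ ℚ.- + 1 ℚ./ suc L) (+ 1 ℚ./ d) ⟩
  toℚᵘ (ℚ.1ℚ ℚ.- + 1 ℚ./ suc L) ℚᵘ.* toℚᵘ (+ 1 ℚ./ d) ≈⟨ ℚᵘ.*-cong 1-1/[1+L] (toℚᵘ-/ (+ 1) d) ⟩
  (ℚᵘ.1ℚᵘ ℚᵘ.- + 1 ℚᵘ./ suc L) ℚᵘ.* (+ 1 ℚᵘ./ d)      ≈⟨ ℚᵘ.*≡* cross-multiplied ⟩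
  + L ℚᵘ./ (suc L * d)                                ≈⟨ toℚᵘ-/ (+ L) (suc L * d) ⟨
  toℚᵘ (+ L ℚ./ (suc L * d))                          ∎)
  where
  open ℚᵘ.≃-Reasoning
  1-1/[1+L] : toℚᵘ (ℚ.1ℚ ℚ.- + 1 ℚ./ suc L) ℚᵘ.≃ ℚᵘ.1ℚᵘ ℚᵘ.- + 1 ℚᵘ./ suc L
  1-1/[1+L] = ℚᵘ.≃-trans (toℚᵘ-homo-+ ℚ.1ℚ (ℚ.- (+ 1 ℚ./ suc L)))
    (ℚᵘ.+-congʳ ℚᵘ.1ℚᵘ (ℚᵘ.≃-trans (toℚᵘ-homo‿- (+ 1 ℚ./ suc L)) (ℚᵘ.-‿cong (toℚᵘ-/ (+ 1) (suc L)))))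
  -- The unnormalised numerator of 1 - 1/(1+L) computes to + (L + 0), not + L.
  cross-multiplied : + (L + 0) ℤ.* + 1 ℤ.* + (suc L * d) ≡ + L ℤ.* + (1 * suc L * d)
  cross-multiplied = trans
    (cong (ℤ._* + (suc L * d)) (trans (ℤ.*-identityʳ (+ (L + 0))) (cong +_ (+-identityʳ L))))
    (cong (λ k → + L ℤ.* + (k * d)) (sym (*-identityˡ (suc L))))

theorem3 : (d N c m : ℕ) → .{{_ : NonZero d}} → .{{_ : NonZero m}} → d ≤ N →
    ((∀ (n : ℕ) → n ≤ N → n / d ≡ (c Data.Nat.* n Data.Nat.+ c) / m)
    ⇔ (((ℚ.1ℚ ℚ.- (+ 1) ℚ./ suc (N ∸ N % d)) ℚ.* ((+ 1) ℚ./ d) ℚ.≤ (+ c) ℚ./ m)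
    × ((+ c) ℚ./ m ℚ.< (+ 1) ℚ./ d)))
theorem3 d N c m d≤N = ⇔.trans (floorsAgree⇔ {c = c} d≤N) (⇔.sym (lowerBound ×-⇔ upperBound))
  where
  L = N ∸ N % d
  Q = N / d
  lowerBound : (ℚ.1ℚ ℚ.- + 1 ℚ./ suc L) ℚ.* (+ 1 ℚ./ d) ℚ.≤ + c ℚ./ m ⇔ Q * m ≤ c * (Q * d) + c
  lowerBound = ⇔.trans
    (subst (λ x → (x ℚ.≤ + c ℚ./ m) ⇔ (L * m ≤ c * (suc L * d))) (sym ([1-1/[1+L]]*[1/d]≡L/[[1+L]*d] L d))
      (+a/b≤+c/e⇔a*e≤c*b L (suc L * d) c m {{m*n≢0 (suc L) d}}))
    (subst (λ x → (x * m ≤ c * (suc x * d)) ⇔ (Q * m ≤ c * (Q * d) + c)) (sym (m∸m%n≡m/n*n N d))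
      (Q*d*m≤c*[[1+Q*d]*d]⇔Q*m≤c*[Q*d]+c Q d m c))
  upperBound : + c ℚ./ m ℚ.< + 1 ℚ./ d ⇔ c * d < m
  upperBound = subst (λ x → (+ c ℚ./ m ℚ.< + 1 ℚ./ d) ⇔ (c * d < x)) (*-identityˡ m) (+a/b<+c/e⇔a*e<c*b c m 1 d)
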